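{- Let $G=(V,E)$ be a $k$-regular graph with $|V|=n$, let $p\in V$, and let $S\subseteq V\setminus\{p\}$ be such that $p$ is the unique vertex of maximum degree in the induced subgraph $G[V\setminus S]$. Let $f=|N(p)\setminus S|$. Then $$|S|\ \ge\ \frac{(k-f+1)n-1}{2k-f+1}\ \ge\ \frac{n-1}{k+1}.$$
   Context: $N(p)$ is the set of neighbours of $p$ in $G$; a graph is $k$-regular if every vertex has degree exactly $k$. -}

module Defs where

open import Data.Nat using (ℕ; suc; _+_; _*_; _∸_; _<_)
open import Data.Bool using (Bool; true; false)
open import Data.Fin using (Fin)
open import Data.Fin.Subset using (Subset; ∣_∣; _─_; _∉_)
open import Data.Vec using (tabulate)
open import Relation.Binary.PropositionalEquality using (_≡_)
open import Relation.Nullary using (¬_)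

record SimpleGraph (n : ℕ) : Set where
  field
    adj   : Fin n → Fin n → Bool
    sym   : ∀ u v → adj u v ≡ adj v u
    irref : ∀ v → adj v v ≡ false

open SimpleGraph public

N : ∀ {n} → SimpleGraph n → Fin n → Subset n
N G v = tabulate (adj G v)

degree : ∀ {n} → SimpleGraph n → Fin n → ℕ
degree G v = ∣ N G v ∣

Regular : ∀ {n} → SimpleGraph n → ℕ → Set
Regular G k = ∀ v → degree G v ≡ k

-- degree of v (assumed outside S) in the induced subgraph G[V \ S]
inducedDegree : ∀ {n} → SimpleGraph n → Subset n → Fin n → ℕ
inducedDegree G S v = ∣ N G v ─ S ∣

UniqueMaxDegree : ∀ {n} → SimpleGraph n → Subset n → Fin n → Set
UniqueMaxDegree G S p =
  p ∉ S × (∀ v → v ∉ S → ¬ (v ≡ p) → inducedDegree G S v < inducedDegree G S p)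
  where open import Data.Product using (_×_)

-- Count the edges between S and its complement T.  Each vertex of S sends at
-- most k of them to T.  Each vertex v ≠ p of T has fewer than f neighbours in
-- T, hence at least k − f + 1 in S, while p has exactly k − f.  So
-- |T|(k − f + 1) − 1 ≤ k|S|, which with |T| = n − |S| is the first
-- inequality; the second is elementary arithmetic for n ≥ 1.
module Submission where

open import Defs renaming (sym to adj-sym)
open import Data.Bool using (Bool; true; false; _∧_)
open import Data.Fin using (Fin; zero; suc)
open import Data.Fin.Properties using (_≟_)
open import Data.Fin.Subset using (Subset; ∣_∣; _─_; _∩_; ∁; ⁅_⁆; _∈_; _∉_; inside; outside)
open import Data.Fin.Subset.Properties
  using (_∈?_; ∣p∣≤n; ∣∁p∣≡n∸∣p∣; ∣⁅x⁆∣≡1; ∣p─q∣≤∣p∣; ∣p∩q∣≤∣p∣; x∈⁅x⁆; x∈⁅y⁆⇒x≡y; x∈p⇒x∉∁p; x∉p⇒x∈∁p)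
open import Data.Integer using (+_; _-_; +≤+) renaming (_*_ to _*ℤ_; _≤_ to _≤ℤ_)
import Data.Integer.Properties as ℤ
open import Data.Nat using (ℕ; zero; suc; _+_; _*_; _∸_; _≤_; z≤n; s≤s⁻¹)
open import Data.Nat.Properties
  using (+-*-semiring; +-comm; +-suc; +-identityʳ; *-identityˡ; *-identityʳ; *-assoc; ≤-reflexive; ≤-trans;
         +-mono-≤; +-monoˡ-≤; +-monoʳ-≤; *-monoʳ-≤; m≤m+n; m+n∸m≡n; m+[n∸m]≡n; +-∸-assoc; ∸-monoʳ-<;
         module ≤-Reasoning)
open import Data.Nat.Tactic.RingSolver using (solve-∀)
open import Data.Product using (_×_; _,_; proj₂)
open import Data.Rational using (_/_) renaming (_≤_ to _≤ℚ_)
open import Data.Rational.Properties using (toℚᵘ-cancel-≤; toℚᵘ-fromℚᵘ)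
open import Data.Rational.Unnormalised using (mkℚᵘ; *≤*)
open import Data.Rational.Unnormalised.Properties using (≤-respˡ-≃; ≤-respʳ-≃; ≃-sym)
open import Data.Vec using (lookup; []; _∷_)
open import Data.Vec.Properties using ([]=⇒lookup; lookup⇒[]=; lookup∘tabulate; lookup-zipWith)
open import Function using (_∘_)
open import Relation.Binary.PropositionalEquality
open import Relation.Nullary using (yes; no; contradiction)

open import Algebra.Properties.Semiring.Sum +-*-semiring
  using (sum; sum-syntax; ∑-distrib-+; ∑-comm; sum-cong-≗; *-distribˡ-sum; *-distribʳ-sum)

private
  variable
    n : ℕ

𝟙 : Bool → ℕ
𝟙 true  = 1
𝟙 false = 0

𝟙-∧ : ∀ x y → 𝟙 (x ∧ y) ≡ 𝟙 x * 𝟙 y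
𝟙-∧ true  y = sym (+-identityʳ (𝟙 y))
𝟙-∧ false y = refl

χ : Subset n → Fin n → ℕ
χ p i = 𝟙 (lookup p i)

χ-∈ : ∀ {p : Subset n} {x} → x ∈ p → χ p x ≡ 1
χ-∈ x∈p = cong 𝟙 ([]=⇒lookup x∈p)

χ-∉ : ∀ {p : Subset n} {x} → x ∉ p → χ p x ≡ 0
χ-∉ {p = p} {x} x∉p with lookup p x in eq
... | true  = contradiction (lookup⇒[]= x p eq) x∉p
... | false = refl

∑-mono-≤ : ∀ {f g : Fin n → ℕ} → (∀ i → f i ≤ g i) → ∑[ i < n ] f i ≤ ∑[ i < n ] g i
∑-mono-≤ {zero}  f≤g = z≤n
∑-mono-≤ {suc n} f≤g = +-mono-≤ (f≤g zero) (∑-mono-≤ (f≤g ∘ suc))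

∣p∣≡∑χ : ∀ (p : Subset n) → ∣ p ∣ ≡ ∑[ i < n ] χ p i
∣p∣≡∑χ []            = refl
∣p∣≡∑χ (inside  ∷ p) = cong suc (∣p∣≡∑χ p)
∣p∣≡∑χ (outside ∷ p) = ∣p∣≡∑χ p

∑χ*≡∣p∣* : ∀ (p : Subset n) c → ∑[ i < n ] (χ p i * c) ≡ ∣ p ∣ * c
∑χ*≡∣p∣* p c = begin
  ∑[ i < _ ] (χ p i * c) ≡⟨ *-distribʳ-sum c (χ p) ⟨
  sum (χ p) * c         ≡⟨ cong (_* c) (∣p∣≡∑χ p) ⟨
  ∣ p ∣ * c             ∎
  where open ≡-Reasoning

∣p─q∣+∣p∩q∣≡∣p∣ : ∀ (p q : Subset n) → ∣ p ─ q ∣ + ∣ p ∩ q ∣ ≡ ∣ p ∣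
∣p─q∣+∣p∩q∣≡∣p∣ []            []            = refl
∣p─q∣+∣p∩q∣≡∣p∣ (outside ∷ p) (outside ∷ q) = ∣p─q∣+∣p∩q∣≡∣p∣ p q
∣p─q∣+∣p∩q∣≡∣p∣ (outside ∷ p) (inside  ∷ q) = ∣p─q∣+∣p∩q∣≡∣p∣ p q
∣p─q∣+∣p∩q∣≡∣p∣ (inside  ∷ p) (outside ∷ q) = cong suc (∣p─q∣+∣p∩q∣≡∣p∣ p q)
∣p─q∣+∣p∩q∣≡∣p∣ (inside  ∷ p) (inside  ∷ q) = trans (+-suc _ _) (cong suc (∣p─q∣+∣p∩q∣≡∣p∣ p q))

∣p∣+∣∁p∣≡n : ∀ (p : Subset n) → ∣ p ∣ + ∣ ∁ p ∣ ≡ n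
∣p∣+∣∁p∣≡n p = trans (cong (_+_ ∣ p ∣) (∣∁p∣≡n∸∣p∣ p)) (m+[n∸m]≡n (∣p∣≤n p))

∣N∩B∣≡∑ : ∀ (G : SimpleGraph n) B u → ∣ N G u ∩ B ∣ ≡ ∑[ v < n ] (𝟙 (adj G u v) * χ B v)
∣N∩B∣≡∑ G B u = trans (∣p∣≡∑χ (N G u ∩ B)) (sum-cong-≗ χ-N∩B)
  where
  χ-N∩B : ∀ v → χ (N G u ∩ B) v ≡ 𝟙 (adj G u v) * χ B v
  χ-N∩B v = begin
    𝟙 (lookup (N G u ∩ B) v)          ≡⟨ cong 𝟙 (lookup-zipWith _∧_ v (N G u) B) ⟩
    𝟙 (lookup (N G u) v ∧ lookup B v)  ≡⟨ cong (λ b → 𝟙 (b ∧ lookup B v)) (lookup∘tabulate (adj G u) v) ⟩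
    𝟙 (adj G u v ∧ lookup B v)         ≡⟨ 𝟙-∧ (adj G u v) (lookup B v) ⟩
    𝟙 (adj G u v) * χ B v              ∎
    where open ≡-Reasoning

edgesBetween : SimpleGraph n → Subset n → Subset n → ℕ
edgesBetween {n} G A B = ∑[ u < n ] ∑[ v < n ] (χ A u * 𝟙 (adj G u v) * χ B v)

edgesBetween-comm : ∀ (G : SimpleGraph n) A B → edgesBetween G A B ≡ edgesBetween G B A
edgesBetween-comm G A B =
  trans (∑-comm (λ u v → χ A u * 𝟙 (adj G u v) * χ B v)) (sum-cong-≗ λ v → sum-cong-≗ λ u → edge-flip u v)
  where
  open ≡-Reasoning
  *-flip : ∀ x a y → x * a * y ≡ y * a * x
  *-flip = solve-∀
  edge-flip : ∀ u v → χ A u * 𝟙 (adj G u v) * χ B v ≡ χ B v * 𝟙 (adj G v u) * χ A u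
  edge-flip u v = begin
    χ A u * 𝟙 (adj G u v) * χ B v  ≡⟨ *-flip (χ A u) (𝟙 (adj G u v)) (χ B v) ⟩
    χ B v * 𝟙 (adj G u v) * χ A u  ≡⟨ cong (λ b → χ B v * 𝟙 b * χ A u) (adj-sym G u v) ⟩
    χ B v * 𝟙 (adj G v u) * χ A u  ∎

edgesBetween≡∑χ*∣N∩∣ : ∀ (G : SimpleGraph n) A B →
                        edgesBetween G A B ≡ ∑[ u < n ] (χ A u * ∣ N G u ∩ B ∣)
edgesBetween≡∑χ*∣N∩∣ {n} G A B = sum-cong-≗ λ u → begin
  ∑[ v < n ] (χ A u * 𝟙 (adj G u v) * χ B v)    ≡⟨ sum-cong-≗ (λ v → *-assoc (χ A u) (𝟙 (adj G u v)) (χ B v)) ⟩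
  ∑[ v < n ] (χ A u * (𝟙 (adj G u v) * χ B v))  ≡⟨ *-distribˡ-sum (χ A u) (λ v → 𝟙 (adj G u v) * χ B v) ⟨
  χ A u * ∑[ v < n ] (𝟙 (adj G u v) * χ B v)    ≡⟨ cong (χ A u *_) (∣N∩B∣≡∑ G B u) ⟨
  χ A u * ∣ N G u ∩ B ∣                         ∎
  where open ≡-Reasoning

edgesBetween≤∣A∣*k : ∀ {k} (G : SimpleGraph n) → Regular G k → ∀ A B → edgesBetween G A B ≤ ∣ A ∣ * k
edgesBetween≤∣A∣*k {n} {k} G regular A B = begin
  edgesBetween G A B                 ≡⟨ edgesBetween≡∑χ*∣N∩∣ G A B ⟩
  ∑[ u < n ] (χ A u * ∣ N G u ∩ B ∣)  ≤⟨ ∑-mono-≤ (λ u → *-monoʳ-≤ (χ A u) (∣N∩B∣≤k u)) ⟩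
  ∑[ u < n ] (χ A u * k)              ≡⟨ ∑χ*≡∣p∣* A k ⟩
  ∣ A ∣ * k                           ∎
  where
  open ≤-Reasoning
  ∣N∩B∣≤k : ∀ u → ∣ N G u ∩ B ∣ ≤ k
  ∣N∩B∣≤k u = ≤-trans (∣p∩q∣≤∣p∣ (N G u) B) (≤-reflexive (regular u))

module _ {k} (G : SimpleGraph n) (regular : Regular G k) {S : Subset n} {p : Fin n}
         (uniqueMax : UniqueMaxDegree G S p) where

  private
    f : ℕ
    f = inducedDegree G S p

    k∸inducedDegree≡∣N∩S∣ : ∀ v → k ∸ inducedDegree G S v ≡ ∣ N G v ∩ S ∣
    k∸inducedDegree≡∣N∩S∣ v =
      subst (λ k → k ∸ inducedDegree G S v ≡ ∣ N G v ∩ S ∣)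
            (trans (∣p─q∣+∣p∩q∣≡∣p∣ (N G v) S) (regular v))
            (m+n∸m≡n (inducedDegree G S v) ∣ N G v ∩ S ∣)

  inducedDegree≤k : f ≤ k
  inducedDegree≤k = ≤-trans (∣p─q∣≤∣p∣ (N G p) S) (≤-reflexive (regular p))

  k∸f+1≤∣N∩S∣+χ⁅p⁆ : ∀ v → v ∉ S → k ∸ f + 1 ≤ ∣ N G v ∩ S ∣ + χ ⁅ p ⁆ v
  k∸f+1≤∣N∩S∣+χ⁅p⁆ v v∉S with v ≟ p
  ... | yes refl rewrite χ-∈ (x∈⁅x⁆ p) = ≤-reflexive (cong (_+ 1) (k∸inducedDegree≡∣N∩S∣ p))
  ... | no v≢p rewrite χ-∉ (v≢p ∘ x∈⁅y⁆⇒x≡y p) = begin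
    k ∸ f + 1                ≡⟨ +-comm (k ∸ f) 1 ⟩
    suc (k ∸ f)              ≤⟨ ∸-monoʳ-< (proj₂ uniqueMax v v∉S v≢p) inducedDegree≤k ⟩
    k ∸ inducedDegree G S v  ≡⟨ k∸inducedDegree≡∣N∩S∣ v ⟩
    ∣ N G v ∩ S ∣            ≡⟨ +-identityʳ _ ⟨
    ∣ N G v ∩ S ∣ + 0        ∎
    where open ≤-Reasoning

  ∣∁S∣*[k∸f+1]≤∣S∣*k+1 : ∣ ∁ S ∣ * (k ∸ f + 1) ≤ ∣ S ∣ * k + 1
  ∣∁S∣*[k∸f+1]≤∣S∣*k+1 = begin
    ∣ ∁ S ∣ * (k ∸ f + 1)                                 ≡⟨ ∑χ*≡∣p∣* (∁ S) (k ∸ f + 1) ⟨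
    ∑[ v < n ] (χ (∁ S) v * (k ∸ f + 1))                   ≤⟨ ∑-mono-≤ perVertex ⟩
    ∑[ v < n ] (χ (∁ S) v * ∣ N G v ∩ S ∣ + χ ⁅ p ⁆ v)      ≡⟨ ∑-distrib-+ (λ v → χ (∁ S) v * ∣ N G v ∩ S ∣) (χ ⁅ p ⁆) ⟩
    ∑[ v < n ] (χ (∁ S) v * ∣ N G v ∩ S ∣) + sum (χ ⁅ p ⁆)  ≡⟨ cong₂ _+_ (edgesBetween≡∑χ*∣N∩∣ G (∁ S) S) (∣p∣≡∑χ ⁅ p ⁆) ⟨
    edgesBetween G (∁ S) S + ∣ ⁅ p ⁆ ∣                     ≡⟨ cong₂ _+_ (edgesBetween-comm G (∁ S) S) (∣⁅x⁆∣≡1 p) ⟩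
    edgesBetween G S (∁ S) + 1                             ≤⟨ +-monoˡ-≤ 1 (edgesBetween≤∣A∣*k G regular S (∁ S)) ⟩
    ∣ S ∣ * k + 1                                          ∎
    where
    open ≤-Reasoning
    perVertex : ∀ v → χ (∁ S) v * (k ∸ f + 1) ≤ χ (∁ S) v * ∣ N G v ∩ S ∣ + χ ⁅ p ⁆ v
    perVertex v with v ∈? S
    ... | yes v∈S rewrite χ-∉ (x∈p⇒x∉∁p v∈S) = z≤n
    ... | no  v∉S rewrite χ-∈ (x∉p⇒x∈∁p v∉S) | *-identityˡ (k ∸ f + 1) | *-identityˡ ∣ N G v ∩ S ∣ =
      k∸f+1≤∣N∩S∣+χ⁅p⁆ v v∉S

*≤*⇒/≤/ : ∀ a b c d → a * suc d ≤ c * suc b → + a / suc b ≤ℚ + c / suc d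
*≤*⇒/≤/ a b c d ad≤cb = toℚᵘ-cancel-≤
  (≤-respˡ-≃ (≃-sym (toℚᵘ-fromℚᵘ (mkℚᵘ (+ a) b)))
    (≤-respʳ-≃ (≃-sym (toℚᵘ-fromℚᵘ (mkℚᵘ (+ c) d)))
      (*≤* (subst₂ _≤ℤ_ (ℤ.pos-* a (suc d)) (ℤ.pos-* c (suc b)) (+≤+ ad≤cb)))))

ratio-bounds : ∀ {k c m s t} → s + t ≡ suc m → t * suc c ≤ s * k + 1 →
  ((((+ suc c) *ℤ (+ suc m)) - (+ 1)) / suc (k + c) ≤ℚ (+ s) / 1)
  × (((+ suc m) - (+ 1)) / suc k ≤ℚ (((+ suc c) *ℤ (+ suc m)) - (+ 1)) / suc (k + c))
-- The numerator (+ suc c *ℤ + suc m) - + 1 computes to + (m + c * suc m).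
ratio-bounds {k} {c} {m} {s} {t} s+t≡n key =
  *≤*⇒/≤/ (m + c * suc m) (k + c) s 0 first , *≤*⇒/≤/ m k (m + c * suc m) (k + c) second
  where
  open ≤-Reasoning
  first : (m + c * suc m) * 1 ≤ s * suc (k + c)
  first = ≤-trans (≤-reflexive (*-identityʳ _)) (s≤s⁻¹ (begin
    suc c * suc m           ≡⟨ cong (suc c *_) s+t≡n ⟨
    suc c * (s + t)         ≡⟨ expand c s t ⟩
    suc c * s + t * suc c   ≤⟨ +-monoʳ-≤ (suc c * s) key ⟩
    suc c * s + (s * k + 1) ≡⟨ collect c s k ⟩
    suc (s * suc (k + c))   ∎))
    where
    expand : ∀ c s t → suc c * (s + t) ≡ suc c * s + t * suc c
    expand = solve-∀
    collect : ∀ c s k → suc c * s + (s * k + 1) ≡ suc (s * suc (k + c))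
    collect = solve-∀
  second : m * suc (k + c) ≤ (m + c * suc m) * suc k
  second = begin
    m * suc (k + c)                           ≤⟨ m≤m+n _ _ ⟩
    m * suc (k + c) + c * suc (m * k + k)     ≡⟨ expand m c k ⟩
    (m + c * suc m) * suc k                   ∎
    where
    expand : ∀ m c k → m * suc (k + c) + c * suc (m * k + k) ≡ (m + c * suc m) * suc k
    expand = solve-∀

2*m∸n≡m+[m∸n] : ∀ {m n} → n ≤ m → 2 * m ∸ n ≡ m + (m ∸ n)
2*m∸n≡m+[m∸n] {m} {n} n≤m = trans (cong (λ m′ → m + m′ ∸ n) (+-identityʳ m)) (+-∸-assoc m n≤m)

ratio-bounds-∸ : ∀ {k f m s t} → f ≤ k → s + t ≡ suc m → t * (k ∸ f + 1) ≤ s * k + 1 →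
  ((((+ (k ∸ f + 1)) *ℤ (+ suc m)) - (+ 1)) / suc (2 * k ∸ f) ≤ℚ (+ s) / 1)
  × (((+ suc m) - (+ 1)) / suc k ≤ℚ (((+ (k ∸ f + 1)) *ℤ (+ suc m)) - (+ 1)) / suc (2 * k ∸ f))
ratio-bounds-∸ {k} {f} {m} {s} {t} f≤k s+t≡n key
  rewrite +-comm (k ∸ f) 1 | 2*m∸n≡m+[m∸n] f≤k = ratio-bounds {k} {k ∸ f} {m} {s} {t} s+t≡n key

lemma3 : (n k : ℕ) (G : SimpleGraph n) → Regular G k →
    (p : Fin n) (S : Subset n) → p ∉ S → UniqueMaxDegree G S p →
    let f = ∣ N G p ─ S ∣ in
    ((((+ (k ∸ f + 1)) *ℤ (+ n)) - (+ 1)) / suc (2 * k ∸ f) ≤ℚ (+ ∣ S ∣) / 1)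
    × (((+ n) - (+ 1)) / suc k ≤ℚ (((+ (k ∸ f + 1)) *ℤ (+ n)) - (+ 1)) / suc (2 * k ∸ f))
-- The hypothesis p ∉ S is unused: it is also the first component of UniqueMaxDegree.
lemma3 (suc m) k G regular p S _ uniqueMax =
  ratio-bounds-∸ {k} {∣ N G p ─ S ∣} {m} {∣ S ∣} {∣ ∁ S ∣}
    (inducedDegree≤k G regular uniqueMax)
    (∣p∣+∣∁p∣≡n S)
    (∣∁S∣*[k∸f+1]≤∣S∣*k+1 G regular uniqueMax)
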